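{- For every integer $t\ge 0$, the class of $(t+1)$-reverse pass sortable permutations has a finite basis.
   Context: Sorting procedure: a permutation $\pi$ is processed using an input sequence (initially $\pi_1,\ldots,\pi_n$), a stack and an output. Let $m$ be the smallest value not yet output. At each step: if the stack's top entry equals $m$, pop it to the output; otherwise, if the input is nonempty, push the next input entry onto the stack. When no move is possible and the stack is nonempty, the remaining stack entries are returned to the input in the reverse of their order in the previous input (i.e. listed from top of stack to bottom), and the procedure is repeated; each run is a reverse pass. The rev-tier $t_{\operatorname{rev}}(\pi)$ is the number of times entries must be returned to the input before the output is $1,2,\ldots,n$. A permutation is $(t+1)$-reverse pass sortable if $t_{\operatorname{rev}}(\pi)\le t$; these permutations form a permutation class (closed under pattern containment). The basis of a class is the set of minimal (under pattern containment) permutations not in the class. -}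

module Defs where

open import Data.Nat using (ℕ; zero; suc; _<_; _≡ᵇ_)
open import Data.Bool using (if_then_else_)
open import Data.List using (List; []; _∷_; length; map; upTo; lookup)
open import Data.List.Relation.Binary.Permutation.Propositional using (_↭_)
open import Data.List.Relation.Binary.Sublist.Propositional using (_⊆_)
open import Data.List.Membership.Propositional using (_∈_)
open import Data.Fin using (Fin; cast)
open import Data.Product using (Σ; _×_; _,_; ∃-syntax)
open import Function.Bundles using (_⇔_)
open import Relation.Binary.PropositionalEquality using (_≡_; _≢_)
open import Relation.Nullary using (¬_)

IsPerm : List ℕ → Set
IsPerm π = π ↭ map suc (upTo (length π))

OrderIso : List ℕ → List ℕ → Set
OrderIso σ τ = Σ (length σ ≡ length τ) λ eq →
  ∀ (i j : Fin (length σ)) →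
    (lookup σ i < lookup σ j) ⇔ (lookup τ (cast eq i) < lookup τ (cast eq j))

Contains : List ℕ → List ℕ → Set
Contains π σ = ∃[ τ ] (τ ⊆ π × OrderIso σ τ)

-- The stack is a list whose head is the top entry.
-- popAll s m : pop while the top of the stack equals m (the smallest value
-- not yet output); returns the new stack and the new m.
popAll : List ℕ → ℕ → List ℕ × ℕ
popAll [] m = [] , m
popAll (x ∷ s) m = if x ≡ᵇ m then popAll s (suc m) else (x ∷ s , m)

-- One pass: input, current stack, current m.  Returns the remaining stack (top first) and the new m.
passGo : List ℕ → List ℕ → ℕ → List ℕ × ℕ
passGo [] s m = popAll s m
passGo (x ∷ xs) s m with popAll s m
... | s' , m' = passGo xs (x ∷ s') m'

-- Run k passes, starting from input xs and smallest unoutput value m.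
-- Between passes the remaining stack, listed from top to bottom, becomes
-- the new input.  Returns the final leftover stack.
runPasses : ℕ → List ℕ → ℕ → List ℕ
runPasses zero xs m = xs
runPasses (suc k) xs m with passGo xs [] m
... | s , m' = runPasses k s m'

-- π is (t+1)-reverse pass sortable, i.e. t_rev(π) ≤ t: after t+1 passes
-- (t returns to the input) nothing remains, i.e. the output is 1,…,n.
RevPassSortable : ℕ → List ℕ → Set
RevPassSortable t π = runPasses (suc t) π 1 ≡ []

IsBasisElement : ℕ → List ℕ → Set
IsBasisElement t β =
  IsPerm β × ¬ RevPassSortable t β ×
  (∀ σ → IsPerm σ → Contains β σ → σ ≢ β → RevPassSortable t σ)

HasFiniteBasis : ℕ → Set
HasFiniteBasis t = ∃[ B ] (∀ β → (β ∈ B) ⇔ IsBasisElement t β)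

module Submission where

-- Call an entry x of a list a '2' if some larger entry and, after it, some
-- smaller entry follow x (x is the '2' of an occurrence of 231).  The proof
-- rests on an explicit description of one reverse pass: on every input
-- arising while sorting a permutation, the entries left on the stack are
-- exactly those at least as large as the least '2', in reverse order
-- (passGo-good).  This idealised pass is monotone for the subsequence order
-- and commutes with strictly increasing relabellings.  Hence if t+1 passes
-- leave something of π, they already do so for a subsequence of π with at
-- most 3(t+1)+1 entries, each pass costing one occurrence of 231
-- (small-witness); its standardisation is an unsortable pattern of π, so
-- every basis element has at most 3(t+1)+1 entries (basis-bound).  All the
-- notions in the statement are decidable, so the basis is obtained by
-- filtering the finitely many short candidate lists.

import Relation.Binary.PropositionalEquality as ≡

open import Defs
open import Data.Nat using (ℕ; zero; suc; _+_; _<_; _≤_; _≤?_; _<?_; _≟_; _≡ᵇ_; z≤n; s≤s; s≤s⁻¹)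
open import Data.Nat.Properties
open import Data.List using (List; []; _∷_; _++_; [_]; filter; reverse; length; map; upTo; lookup; cartesianProductWith)
open import Data.Fin as Fin using (Fin)
import Data.Fin.Properties as Finᵖ
open import Data.List.Properties using (reverse-involutive; length-reverse; reverse-map; filter-accept; filter-reject; filter-all;
    filter-++; reverse-++; ∷-injectiveˡ; unfold-reverse; map-id; ∷ʳ-injectiveʳ; ++-assoc; ++-identityʳ;
    length-++; length-map; length-upTo; filter-notAll; ≡-dec)
open import Data.List.Relation.Unary.Any using (Any; here; there; any?)
open import Data.List.Relation.Unary.All as All using (All; []; _∷_)
open import Data.List.Relation.Unary.All.Properties using (all-filter)
open import Data.List.Relation.Unary.Any.Properties using () renaming (reverse⁺ to ∈-reverse⁺; reverse⁻ to ∈-reverse⁻)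
open import Data.List.Membership.Propositional using (_∈_; _∉_; find; lose)
open import Data.List.Membership.DecPropositional _≟_ using (_∈?_)
open import Data.List.Membership.Propositional.Properties using (∈-filter⁻; ∈-filter⁺; ∈-map⁺; ∈-map⁻; ∈-++⁺ˡ; ∈-++⁺ʳ; ∈-++⁻; ∈-upTo⁺; ∈-upTo⁻; ∈-∃++; ∈-lookup; ∈-cartesianProductWith⁺)
open import Data.List.Relation.Binary.Sublist.Propositional
  using (_⊆_; []; _∷_; _∷ʳ_; ⊆-refl; ⊆-trans; from∈; to∈; minimum)
open import Data.List.Relation.Binary.Sublist.Propositional.Properties
  using (reverse⁺; filter⁺; map⁺; ++⁺; ++⁺ʳ; filter-⊆; length-mono-≤; All-resp-⊆)
open import Data.List.Relation.Unary.Unique.Propositional using (Unique)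
open import Data.List.Relation.Unary.AllPairs using ([]; _∷_)
open import Data.List.Relation.Unary.Unique.DecPropositional _≟_ using (unique?)
import Data.List.Relation.Unary.Unique.Propositional.Properties as Unique
open import Data.List.Relation.Unary.Unique.Propositional.Properties using (Unique[x∷xs]⇒x∉xs)
open import Data.List.Relation.Binary.Permutation.Propositional using (_↭_; ↭-refl; ↭-sym; ↭-trans; ↭-prep; ↭⇒↭ₛ)
open import Data.List.Relation.Binary.Permutation.Propositional.Properties using (↭-reverse; ∷↭∷ʳ; ∈-resp-↭; shift)
import Data.List.Relation.Binary.Permutation.Setoid.Properties as PermutationSetoid
open import Data.Product using (∃; ∃₂; _×_; _,_; proj₁; proj₂)
open import Data.Sum using (_⊎_; inj₁; inj₂)
open import Data.Empty using (⊥-elim)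
open import Data.Bool using (true; false)
open import Data.Unit using (tt)
open import Relation.Nullary using (¬_; Dec; yes; no)
open import Relation.Nullary.Decidable using (_×-dec_; _⊎-dec_; _→-dec_; ¬?; map′)
open import Relation.Unary using (Decidable)
open import Function.Bundles using (_⇔_; mk⇔; Equivalence)
open import Relation.Binary using (tri<; tri≈; tri>)
open import Relation.Binary.PropositionalEquality using (_≡_; _≢_; refl; sym; trans; cong; cong₂; subst; subst₂; module ≡-Reasoning)
open import Function.Base using (_∘_; id)

private
  variable
    A B : Set

filter-map : ∀ {P : B → Set} {Q : A → Set} (P? : Decidable P) (Q? : Decidable Q) (f : A → B) l →
  (∀ {y} → y ∈ l → P (f y) ⇔ Q y) → filter P? (map f l) ≡ map f (filter Q? l)
filter-map P? Q? f [] P⇔Q = refl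
filter-map P? Q? f (x ∷ l) P⇔Q with P? (f x) | Q? x
... | yes _  | yes _  = cong (f x ∷_) (filter-map P? Q? f l (P⇔Q ∘ there))
... | yes p  | no ¬q  = ⊥-elim (¬q (Equivalence.to (P⇔Q (here refl)) p))
... | no ¬p  | yes q  = ⊥-elim (¬p (Equivalence.from (P⇔Q (here refl)) q))
... | no _   | no _   = filter-map P? Q? f l (P⇔Q ∘ there)

filter-cong : ∀ {P Q : A → Set} (P? : Decidable P) (Q? : Decidable Q) l →
  (∀ {y} → y ∈ l → P y ⇔ Q y) → filter P? l ≡ filter Q? l
filter-cong P? Q? l P⇔Q = begin
  filter P? l         ≡⟨ cong (filter P?) (sym (map-id l)) ⟩
  filter P? (map id l) ≡⟨ filter-map P? Q? id l P⇔Q ⟩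
  map id (filter Q? l) ≡⟨ map-id _ ⟩
  filter Q? l         ∎
  where open ≡-Reasoning

filter-absorb : ∀ {P Q : A → Set} (P? : Decidable P) (Q? : Decidable Q) →
  (∀ {y} → P y → Q y) → ∀ xs → filter P? (filter Q? xs) ≡ filter P? xs
filter-absorb P? Q? P⇒Q [] = refl
filter-absorb P? Q? P⇒Q (x ∷ xs) with Q? x
... | yes _ with P? x
...   | yes _ = cong (x ∷_) (filter-absorb P? Q? P⇒Q xs)
...   | no _  = filter-absorb P? Q? P⇒Q xs
filter-absorb P? Q? P⇒Q (x ∷ xs) | no ¬q =
  trans (filter-absorb P? Q? P⇒Q xs) (sym (filter-reject P? (¬q ∘ P⇒Q)))

⊆-filter : ∀ {P : A → Set} (P? : Decidable P) {ρ l : List A} → ρ ⊆ l → All P ρ → ρ ⊆ filter P? l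
⊆-filter P? {ρ} ρ⊆l allP = subst (_⊆ _) (filter-all P? allP) (filter⁺ P? P? (λ { refl p → p }) ρ⊆l)

⊆-nonempty : ∀ {l l′ : List A} → l ⊆ l′ → l ≢ [] → l′ ≢ []
⊆-nonempty [] l≢[] = l≢[]
⊆-nonempty (_ ∷ʳ _) _ ()
⊆-nonempty (_ ∷ _) _ ()

⊆-union : ∀ {a b xs : List A} → a ⊆ xs → b ⊆ xs →
  ∃ λ c → c ⊆ xs × a ⊆ c × b ⊆ c × length c ≤ length a + length b
⊆-union [] [] = [] , [] , [] , [] , z≤n
⊆-union (y ∷ʳ a⊆) (.y ∷ʳ b⊆) =
  let c , c⊆ , a⊆c , b⊆c , len = ⊆-union a⊆ b⊆ in c , y ∷ʳ c⊆ , a⊆c , b⊆c , len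
⊆-union {a = a} (y ∷ʳ a⊆) (refl ∷ b⊆) =
  let c , c⊆ , a⊆c , b⊆c , len = ⊆-union a⊆ b⊆
  in y ∷ c , refl ∷ c⊆ , y ∷ʳ a⊆c , refl ∷ b⊆c , ≤-trans (s≤s len) (≤-reflexive (sym (+-suc (length a) _)))
⊆-union (refl ∷ a⊆) (y ∷ʳ b⊆) =
  let c , c⊆ , a⊆c , b⊆c , len = ⊆-union a⊆ b⊆ in y ∷ c , refl ∷ c⊆ , refl ∷ a⊆c , y ∷ʳ b⊆c , s≤s len
⊆-union {a = x ∷ a} (refl ∷ a⊆) (refl ∷ b⊆) =
  let c , c⊆ , a⊆c , b⊆c , len = ⊆-union a⊆ b⊆
  in x ∷ c , refl ∷ c⊆ , refl ∷ a⊆c , refl ∷ b⊆c , s≤s (≤-trans len (+-monoʳ-≤ (length a) (n≤1+n _)))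

⊆-∷ʳ⁻ : ∀ {l : List A} p x → l ⊆ p ++ [ x ] → l ⊆ p ⊎ ∃ λ l′ → l ≡ l′ ++ [ x ]
⊆-∷ʳ⁻ [] x (_ ∷ʳ l⊆) = inj₁ l⊆
⊆-∷ʳ⁻ [] x (refl ∷ []) = inj₂ ([] , refl)
⊆-∷ʳ⁻ (y ∷ p) x (_ ∷ʳ l⊆) with ⊆-∷ʳ⁻ p x l⊆
... | inj₁ l⊆p = inj₁ (y ∷ʳ l⊆p)
... | inj₂ ends = inj₂ ends
⊆-∷ʳ⁻ (y ∷ p) x (refl ∷ l⊆) with ⊆-∷ʳ⁻ p x l⊆
... | inj₁ l⊆p = inj₁ (refl ∷ l⊆p)
... | inj₂ (l′ , refl) = inj₂ (y ∷ l′ , refl)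

⊆-map⁻ : ∀ (f : A → B) {ys} l → ys ⊆ map f l → ∃ λ τ → τ ⊆ l × ys ≡ map f τ
⊆-map⁻ f [] [] = [] , [] , refl
⊆-map⁻ f (x ∷ l) (_ ∷ʳ s) = let τ , τ⊆ , eq = ⊆-map⁻ f l s in τ , x ∷ʳ τ⊆ , eq
⊆-map⁻ f (x ∷ l) (refl ∷ s) = let τ , τ⊆ , eq = ⊆-map⁻ f l s in x ∷ τ , refl ∷ τ⊆ , cong (f x ∷_) eq

reverse≡∷ : ∀ (l : List A) {z s} → reverse l ≡ z ∷ s → l ≡ reverse s ++ [ z ]
reverse≡∷ l {z} {s} eq = begin
  l                   ≡⟨ sym (reverse-involutive l) ⟩
  reverse (reverse l) ≡⟨ cong reverse eq ⟩
  reverse (z ∷ s)     ≡⟨ unfold-reverse z s ⟩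
  reverse s ++ [ z ]  ∎
  where open ≡-Reasoning

unique-↭ : ∀ {xs ys : List A} → xs ↭ ys → Unique xs → Unique ys
unique-↭ {A = A} xs↭ys = PermutationSetoid.Unique-resp-↭ (≡.setoid A) (↭⇒↭ₛ xs↭ys)

unique-reverse : ∀ {xs : List A} → Unique xs → Unique (reverse xs)
unique-reverse {xs = xs} = unique-↭ (↭-sym (↭-reverse xs))

unique-∷ʳ⇒∉ : ∀ {x : A} p → Unique (p ++ [ x ]) → x ∉ p
unique-∷ʳ⇒∉ {x = x} p uq = Unique[x∷xs]⇒x∉xs (unique-↭ (↭-sym (∷↭∷ʳ x p)) uq)

unique-⊆ : ∀ {xs ys : List A} → Unique xs → ys ⊆ xs → Unique ys
unique-⊆ [] [] = []
unique-⊆ (_ ∷ uq) (_ ∷ʳ ys⊆) = unique-⊆ uq ys⊆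
unique-⊆ (x∉ ∷ uq) (refl ∷ ys⊆) = All-resp-⊆ ys⊆ x∉ ∷ unique-⊆ uq ys⊆

pigeonhole : ∀ (xs ys : List A) → Unique xs → Unique ys → (∀ {a} → a ∈ xs → a ∈ ys) →
  length ys ≤ length xs → xs ↭ ys
pigeonhole [] [] _ _ _ _ = ↭-refl
pigeonhole (a ∷ xs) ys (a∉xs ∷ uxs) uys xs⊆ys len with ∈-∃++ (xs⊆ys (here refl))
... | us , vs , refl =
  ↭-trans (↭-prep a (pigeonhole xs (us ++ vs) uxs (unique-⊆ uys drop-a) xs⊆usvs len′)) (↭-sym (shift a us vs))
  where
  drop-a : us ++ vs ⊆ us ++ a ∷ vs
  drop-a = ++⁺ (⊆-refl {x = us}) (a ∷ʳ ⊆-refl)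
  xs⊆usvs : ∀ {b} → b ∈ xs → b ∈ us ++ vs
  xs⊆usvs {b} b∈ with ∈-++⁻ us (xs⊆ys (there b∈))
  ... | inj₁ b∈us = ∈-++⁺ˡ b∈us
  ... | inj₂ (here refl) = ⊥-elim (All.lookup a∉xs b∈ refl)
  ... | inj₂ (there b∈vs) = ∈-++⁺ʳ us b∈vs
  len′ : length (us ++ vs) ≤ length xs
  len′ = s≤s⁻¹ (begin
    suc (length (us ++ vs))      ≡⟨ cong suc (length-++ us) ⟩
    suc (length us + length vs)  ≡⟨ sym (+-suc (length us) (length vs)) ⟩
    length us + length (a ∷ vs)  ≡⟨ sym (length-++ us) ⟩
    length (us ++ a ∷ vs)        ≤⟨ len ⟩
    suc (length xs)              ∎)
    where open ≤-Reasoning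

least : ∀ {w} (l : List ℕ) → w ∈ l → ∃ λ v → v ∈ l × All (v ≤_) l
least (x ∷ l) _ = least∷ x l
  where
  least∷ : ∀ x l → ∃ λ v → v ∈ x ∷ l × All (v ≤_) (x ∷ l)
  least∷ x [] = x , here refl , ≤-refl ∷ []
  least∷ x (y ∷ l) with least∷ y l
  ... | v , v∈ , v≤ with x ≤? v
  ... | yes x≤v = x , here refl , ≤-refl ∷ All.map (≤-trans x≤v) v≤
  ... | no x≰v = v , there v∈ , <⇒≤ (≰⇒> x≰v) ∷ v≤

StrictOn : (ℕ → ℕ) → List ℕ → Set
StrictOn f l = ∀ {x y} → x ∈ l → y ∈ l → x < y → f x < f y

strictOn-⊆ : ∀ {f l l′} → (∀ {x} → x ∈ l′ → x ∈ l) → StrictOn f l → StrictOn f l′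
strictOn-⊆ l′⊆l st x∈ y∈ = st (l′⊆l x∈) (l′⊆l y∈)

module _ {f : ℕ → ℕ} {l : List ℕ} (st : StrictOn f l) {x y : ℕ} (x∈ : x ∈ l) (y∈ : y ∈ l) where

  strictOn-<⁻ : f x < f y → x < y
  strictOn-<⁻ fx<fy with <-cmp x y
  ... | tri< x<y _ _ = x<y
  ... | tri≈ _ refl _ = ⊥-elim (<-irrefl refl fx<fy)
  ... | tri> _ _ y<x = ⊥-elim (<-asym fx<fy (st y∈ x∈ y<x))

  strictOn-≤ : x ≤ y ⇔ f x ≤ f y
  strictOn-≤ = mk⇔ to from
    where
    to : x ≤ y → f x ≤ f y
    to x≤y with m≤n⇒m<n∨m≡n x≤y
    ... | inj₁ x<y = <⇒≤ (st x∈ y∈ x<y)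
    ... | inj₂ refl = ≤-refl
    from : f x ≤ f y → x ≤ y
    from fx≤fy = ≮⇒≥ (λ y<x → <⇒≱ (st y∈ x∈ y<x) fx≤fy)

unique-map : ∀ {f l} → StrictOn f l → Unique l → Unique (map f l)
unique-map {f} {[]} st [] = []
unique-map {f} {x ∷ l} st (x∉l ∷ ul) = All.tabulate fx≢ ∷ unique-map (strictOn-⊆ there st) ul
  where
  fx≢ : ∀ {z} → z ∈ map f l → f x ≢ z
  fx≢ z∈ fx≡z with ∈-map⁻ f z∈
  ... | y , y∈ , refl with <-cmp x y
  ... | tri< x<y _ _ = <-irrefl fx≡z (st (here refl) (there y∈) x<y)
  ... | tri≈ _ refl _ = All.lookup x∉l y∈ refl
  ... | tri> _ _ y<x = <-irrefl (sym fx≡z) (st (there y∈) (here refl) y<x)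

-- l contains some b > x followed later by some c < x: together with an
-- earlier x this is an occurrence of the pattern 231 with x as its '2'.
Follows31 : ℕ → List ℕ → Set
Follows31 x l = ∃₂ λ b c → (b ∷ c ∷ []) ⊆ l × x < b × c < x

follows31-∷⁺ : ∀ {x y ys} → (x < y × Any (_< x) ys) ⊎ Follows31 x ys → Follows31 x (y ∷ ys)
follows31-∷⁺ (inj₁ (x<y , some<x)) with find some<x
... | c , c∈ , c<x = _ , c , refl ∷ from∈ c∈ , x<y , c<x
follows31-∷⁺ (inj₂ (b , c , bc⊆ , x<b , c<x)) = b , c , _ ∷ʳ bc⊆ , x<b , c<x

follows31-∷⁻ : ∀ {x y ys} → Follows31 x (y ∷ ys) → (x < y × Any (_< x) ys) ⊎ Follows31 x ys
follows31-∷⁻ (b , c , refl ∷ c⊆ , x<b , c<x) = inj₁ (x<b , lose (to∈ c⊆) c<x)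
follows31-∷⁻ (b , c , _ ∷ʳ bc⊆ , x<b , c<x) = inj₂ (b , c , bc⊆ , x<b , c<x)

follows31? : ∀ x l → Dec (Follows31 x l)
follows31? x [] = no λ { (_ , _ , () , _) }
follows31? x (y ∷ ys) =
  map′ follows31-∷⁺ follows31-∷⁻ ((x <? y ×-dec any? (_<? x) ys) ⊎-dec follows31? x ys)

IsTwo : ℕ → List ℕ → Set
IsTwo x l = ∃₂ λ b c → (x ∷ b ∷ c ∷ []) ⊆ l × x < b × c < x

twos : List ℕ → List ℕ
twos [] = []
twos (x ∷ xs) with follows31? x xs
... | yes _ = x ∷ twos xs
... | no _ = twos xs

∈-twos⁻ : ∀ {v} l → v ∈ twos l → IsTwo v l
∈-twos⁻ (x ∷ xs) v∈ with follows31? x xs | v∈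
... | yes (b , c , bc⊆ , x<b , c<x) | here refl = b , c , refl ∷ bc⊆ , x<b , c<x
... | yes _ | there v∈′ = let b , c , s , v<b , c<v = ∈-twos⁻ xs v∈′ in b , c , x ∷ʳ s , v<b , c<v
... | no _  | v∈′ = let b , c , s , v<b , c<v = ∈-twos⁻ xs v∈′ in b , c , x ∷ʳ s , v<b , c<v

∈-twos⁺ : ∀ {v} l → IsTwo v l → v ∈ twos l
∈-twos⁺ (x ∷ xs) (b , c , s , v<b , c<v) with follows31? x xs | s
... | yes _ | refl ∷ _ = here refl
... | yes _ | _ ∷ʳ s′ = there (∈-twos⁺ xs (b , c , s′ , v<b , c<v))
... | no ¬f | refl ∷ bc⊆ = ⊥-elim (¬f (b , c , bc⊆ , v<b , c<v))
... | no _  | _ ∷ʳ s′ = ∈-twos⁺ xs (b , c , s′ , v<b , c<v)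

∈-twos⇒∈ : ∀ {v} l → v ∈ twos l → v ∈ l
∈-twos⇒∈ l v∈ = let _ , _ , s , _ = ∈-twos⁻ l v∈ in to∈ (⊆-trans (refl ∷ minimum _) s)

twos-mono : ∀ {τ l v} → τ ⊆ l → v ∈ twos τ → v ∈ twos l
twos-mono {τ} {l} τ⊆l v∈ = let b , c , s , v<b , c<v = ∈-twos⁻ τ v∈ in ∈-twos⁺ l (b , c , ⊆-trans s τ⊆l , v<b , c<v)

-- y survives a pass over l iff it is at least some '2' of a 231 in l.
Survives : List ℕ → ℕ → Set
Survives l y = Any (_≤ y) (twos l)

survives? : ∀ l → Decidable (Survives l)
survives? l y = any? (_≤? y) (twos l)

-- The idealised pass: the survivors, returned to the input in reverse order.
-- On the inputs arising from permutations it agrees with passGo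
-- (passGo-good below).
pass : List ℕ → List ℕ
pass l = reverse (filter (survives? l) l)

passes : ℕ → List ℕ → List ℕ
passes zero l = l
passes (suc k) l = passes k (pass l)

∈-pass⇒∈ : ∀ {x} l → x ∈ pass l → x ∈ l
∈-pass⇒∈ l x∈ = proj₁ (∈-filter⁻ (survives? l) (∈-reverse⁻ x∈))

survives-mono : ∀ {τ l y} → τ ⊆ l → Survives τ y → Survives l y
survives-mono τ⊆l sv with find sv
... | w , w∈ , w≤y = lose (twos-mono τ⊆l w∈) w≤y

pass-mono : ∀ {τ l} → τ ⊆ l → pass τ ⊆ pass l
pass-mono {τ} {l} τ⊆l =
  reverse⁺ (filter⁺ (survives? τ) (survives? l) (λ { refl → survives-mono τ⊆l }) τ⊆l)

passes-mono : ∀ k {τ l} → τ ⊆ l → passes k τ ⊆ passes k l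
passes-mono zero τ⊆l = τ⊆l
passes-mono (suc k) τ⊆l = passes-mono k (pass-mono τ⊆l)

module _ {f : ℕ → ℕ} where

  follows31-map⁺ : ∀ {x l} → StrictOn f (x ∷ l) → Follows31 x l → Follows31 (f x) (map f l)
  follows31-map⁺ {l = l} st (b , c , bc⊆ , x<b , c<x) =
    f b , f c , map⁺ f bc⊆ , st (here refl) (there b∈) x<b , st (there c∈) (here refl) c<x
    where
    b∈ : b ∈ l
    b∈ = to∈ (⊆-trans (refl ∷ minimum _) bc⊆)
    c∈ : c ∈ l
    c∈ = to∈ (⊆-trans (_ ∷ʳ ⊆-refl) bc⊆)

  follows31-map⁻ : ∀ {x l} → StrictOn f (x ∷ l) → Follows31 (f x) (map f l) → Follows31 x l
  follows31-map⁻ {x} {l} st (_ , _ , bc⊆ , fx<fb , fc<fx) with ⊆-map⁻ f l bc⊆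
  ... | b ∷ c ∷ [] , bc⊆′ , refl =
    b , c , bc⊆′ , strictOn-<⁻ st (here refl) (there b∈) fx<fb , strictOn-<⁻ st (there c∈) (here refl) fc<fx
    where
    b∈ : b ∈ l
    b∈ = to∈ (⊆-trans (refl ∷ minimum _) bc⊆′)
    c∈ : c ∈ l
    c∈ = to∈ (⊆-trans (_ ∷ʳ ⊆-refl) bc⊆′)

  twos-map : ∀ l → StrictOn f l → twos (map f l) ≡ map f (twos l)
  twos-map [] st = refl
  twos-map (x ∷ l) st with follows31? (f x) (map f l) | follows31? x l
  ... | yes _  | yes _  = cong (f x ∷_) (twos-map l (strictOn-⊆ there st))
  ... | yes fp | no ¬p  = ⊥-elim (¬p (follows31-map⁻ st fp))
  ... | no ¬fp | yes p  = ⊥-elim (¬fp (follows31-map⁺ st p))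
  ... | no _   | no _   = twos-map l (strictOn-⊆ there st)

  survives-map : ∀ {l y} → StrictOn f l → y ∈ l → Survives (map f l) (f y) ⇔ Survives l y
  survives-map {l} {y} st y∈ = mk⇔ to from
    where
    to : Survives (map f l) (f y) → Survives l y
    to sv with find sv
    ... | w′ , w′∈ , w′≤fy with ∈-map⁻ f (subst (w′ ∈_) (twos-map l st) w′∈)
    ... | w , w∈ , refl = lose w∈ (Equivalence.from (strictOn-≤ st (∈-twos⇒∈ l w∈) y∈) w′≤fy)
    from : Survives l y → Survives (map f l) (f y)
    from sv with find sv
    ... | w , w∈ , w≤y = subst (Any (_≤ f y)) (sym (twos-map l st))
      (lose (∈-map⁺ f w∈) (Equivalence.to (strictOn-≤ st (∈-twos⇒∈ l w∈) y∈) w≤y))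

  pass-map : ∀ l → StrictOn f l → pass (map f l) ≡ map f (pass l)
  pass-map l st = begin
    reverse (filter (survives? (map f l)) (map f l)) ≡⟨ cong reverse (filter-map (survives? (map f l)) (survives? l) f l (survives-map st)) ⟩
    reverse (map f (filter (survives? l) l))          ≡⟨ sym (reverse-map f (filter (survives? l) l)) ⟩
    map f (reverse (filter (survives? l) l))          ∎
    where open ≡-Reasoning

  passes-map : ∀ k l → StrictOn f l → passes k (map f l) ≡ map f (passes k l)
  passes-map zero l st = refl
  passes-map (suc k) l st = begin
    passes k (pass (map f l)) ≡⟨ cong (passes k) (pass-map l st) ⟩
    passes k (map f (pass l)) ≡⟨ passes-map k (pass l) (strictOn-⊆ (∈-pass⇒∈ l) st) ⟩
    map f (passes (suc k) l)  ∎
    where open ≡-Reasoning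

⊆-pass⇒⊆-kept : ∀ {ρ} xs → ρ ⊆ pass xs → reverse ρ ⊆ filter (survives? xs) xs
⊆-pass⇒⊆-kept {ρ} xs ρ⊆ = subst (reverse ρ ⊆_) (reverse-involutive _) (reverse⁺ ρ⊆)

⊆-kept⇒⊆-pass : ∀ {ρ} xs → reverse ρ ⊆ filter (survives? xs) xs → ρ ⊆ pass xs
⊆-kept⇒⊆-pass {ρ} xs ρʳ⊆ = subst (_⊆ pass xs) (reverse-involutive ρ) (reverse⁺ ρʳ⊆)

-- A subsequence ρ of pass xs is already a subsequence of pass τ for a
-- subsequence τ of xs having at most three more entries: τ consists of ρ
-- together with an occurrence of 231 whose '2' is the least '2' in xs.
pass-witness : ∀ xs {ρ} → ρ ⊆ pass xs → ∃ λ τ → τ ⊆ xs × length τ ≤ 3 + length ρ × ρ ⊆ pass τ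
pass-witness xs {[]} _ = [] , minimum xs , z≤n , []
pass-witness xs {y ∷ ρ} yρ⊆
  with find (proj₂ (∈-filter⁻ (survives? xs) {xs = xs} (∈-reverse⁻ (to∈ (⊆-trans (refl ∷ minimum ρ) yρ⊆)))))
... | w , w∈ , _ with least (twos xs) w∈
... | v , v∈ , v-least with ∈-twos⁻ xs v∈
... | b , c , vbc⊆ , v<b , c<v
  with ⊆-union (⊆-trans (⊆-pass⇒⊆-kept xs yρ⊆) (filter-⊆ (survives? xs) xs)) vbc⊆
... | τ , τ⊆xs , ρʳ⊆τ , vbc⊆τ , τ-length = τ , τ⊆xs , length-bound , yρ⊆pass-τ
  where
  length-bound : length τ ≤ 3 + length (y ∷ ρ)
  length-bound = ≤-trans τ-length (≤-reflexive (trans (cong (_+ 3) (length-reverse (y ∷ ρ))) (+-comm _ 3)))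
  -- every survivor of xs is at least v, hence survives in τ, where v is a '2'
  survives-τ : ∀ {x} → Survives xs x → Survives τ x
  survives-τ sv = let u , u∈ , u≤x = find sv
                  in lose (∈-twos⁺ τ (b , c , vbc⊆τ , v<b , c<v)) (≤-trans (All.lookup v-least u∈) u≤x)
  yρ⊆pass-τ : y ∷ ρ ⊆ pass τ
  yρ⊆pass-τ = ⊆-kept⇒⊆-pass τ (⊆-filter (survives? τ) ρʳ⊆τ
    (All.map survives-τ (All-resp-⊆ (⊆-pass⇒⊆-kept xs yρ⊆) (all-filter (survives? xs) xs))))

witnessBound : ℕ → ℕ
witnessBound zero = 1
witnessBound (suc k) = 3 + witnessBound k

small-witness : ∀ k xs → passes k xs ≢ [] →
  ∃ λ τ → τ ⊆ xs × length τ ≤ witnessBound k × passes k τ ≢ []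
small-witness zero [] nonempty = ⊥-elim (nonempty refl)
small-witness zero (x ∷ xs) _ = x ∷ [] , refl ∷ minimum xs , ≤-refl , λ ()
small-witness (suc k) xs nonempty with small-witness k (pass xs) nonempty
... | ρ , ρ⊆ , ρ-length , ρ-nonempty with pass-witness xs ρ⊆
... | τ , τ⊆xs , τ-length , ρ⊆pass-τ =
  τ , τ⊆xs , ≤-trans τ-length (+-monoʳ-≤ 3 ρ-length) , ⊆-nonempty (passes-mono k ρ⊆pass-τ) ρ-nonempty

-- The entries of q that are ≥ m: those of q not yet output while m is the
-- smallest value not yet output.
above : ℕ → List ℕ → List ℕ
above m q = filter (m ≤?_) q

-- u is on top of the stack holding the unoutput entries of q, when u is
-- the next value to output.
OnTop : List ℕ → ℕ → Set
OnTop q u = ∃ λ s → reverse (above u q) ≡ u ∷ s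

Covered : List ℕ → ℕ → Set
Covered q u = ∃ λ b → (u ∷ b ∷ []) ⊆ q × u < b

isTwo⇒covered : ∀ {q u} → IsTwo u q → Covered q u
isTwo⇒covered (b , c , ubc⊆ , u<b , _) = b , ⊆-trans (refl ∷ refl ∷ minimum _) ubc⊆ , u<b

stack-unique : ∀ {q} u → Unique q → Unique (reverse (above u q))
stack-unique u uq = unique-reverse (Unique.filter⁺ (u ≤?_) uq)

pop-step : ∀ {q u s} → Unique q → reverse (above u q) ≡ u ∷ s → reverse (above (suc u) q) ≡ s
pop-step {q} {u} {s} uq top = begin
  reverse (above (suc u) q)                       ≡⟨ cong reverse (sym (filter-absorb (suc u ≤?_) (u ≤?_) <⇒≤ q)) ⟩
  reverse (filter (suc u ≤?_) (above u q))        ≡⟨ cong (λ l → reverse (filter (suc u ≤?_) l)) (reverse≡∷ (above u q) top) ⟩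
  reverse (filter (suc u ≤?_) (reverse s ++ [ u ])) ≡⟨ cong reverse (filter-++ (suc u ≤?_) (reverse s) [ u ]) ⟩
  reverse (filter (suc u ≤?_) (reverse s) ++ filter (suc u ≤?_) [ u ])
    ≡⟨ cong₂ (λ a b → reverse (a ++ b)) (filter-all (suc u ≤?_) s-above) (filter-reject (suc u ≤?_) (<-irrefl refl)) ⟩
  reverse (reverse s ++ [])                      ≡⟨ cong reverse (++-identityʳ (reverse s)) ⟩
  reverse (reverse s)                            ≡⟨ reverse-involutive s ⟩
  s                                              ∎
  where
  open ≡-Reasoning
  u∉s : u ∉ s
  u∉s = Unique[x∷xs]⇒x∉xs (subst Unique top (stack-unique u uq))
  s-above : All (u <_) (reverse s)
  s-above = All.tabulate λ {y} y∈ →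
    let y∈above = subst (y ∈_) (sym (reverse≡∷ (above u q) top)) (∈-++⁺ˡ y∈)
    in ≤∧≢⇒< (proj₂ (∈-filter⁻ (u ≤?_) {xs = q} y∈above)) (λ { refl → u∉s (∈-reverse⁻ y∈) })

onTop⇒∈ : ∀ {q u} → OnTop q u → u ∈ q
onTop⇒∈ {q} {u} (s , top) = proj₁ (∈-filter⁻ (u ≤?_) {xs = q} (∈-reverse⁻ (subst (u ∈_) (sym top) (here refl))))

-- An entry on top of the stack has no larger entry after it: such an
-- entry would lie above it on the stack.
onTop⇒¬covered : ∀ {q u} → Unique q → OnTop q u → ¬ Covered q u
onTop⇒¬covered {q} {u} uq (s , top) (b , ub⊆ , u<b) =
  Unique[x∷xs]⇒x∉xs (subst Unique top (stack-unique u uq)) (second-in-tail bu⊆)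
  where
  bu⊆ : (b ∷ u ∷ []) ⊆ u ∷ s
  bu⊆ = subst ((b ∷ u ∷ []) ⊆_) top (reverse⁺ (⊆-filter (u ≤?_) ub⊆ (≤-refl ∷ <⇒≤ u<b ∷ [])))
  second-in-tail : ∀ {b u : ℕ} {s} → (b ∷ u ∷ []) ⊆ u ∷ s → u ∈ s
  second-in-tail (_ ∷ʳ bu⊆) = to∈ (⊆-trans (_ ∷ʳ ⊆-refl) bu⊆)
  second-in-tail (refl ∷ u⊆) = to∈ u⊆

-- Conversely an entry that is not on top when needed is covered: the top
-- entry is larger and comes after it.
¬onTop⇒covered : ∀ {q u} → u ∈ q → ¬ OnTop q u → Covered q u
¬onTop⇒covered {q} {u} u∈ ¬top with reverse (above u q) in top
... | [] = ⊥-elim (¬in-[] (subst (u ∈_) top (∈-reverse⁺ (∈-filter⁺ (u ≤?_) u∈ ≤-refl))))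
  where
  ¬in-[] : u ∉ []
  ¬in-[] ()
... | z ∷ s with z ≟ u
...   | yes refl = ⊥-elim (¬top (s , refl))
...   | no z≢u = z , ⊆-trans (subst ((u ∷ z ∷ []) ⊆_) (sym above≡) (++⁺ (from∈ u∈s) ⊆-refl)) (filter-⊆ (u ≤?_) q) , u<z
  where
  above≡ : above u q ≡ reverse s ++ [ z ]
  above≡ = reverse≡∷ (above u q) top
  u∈s : u ∈ reverse s
  u∈s with ∈-++⁻ (reverse s) (subst (u ∈_) above≡ (∈-filter⁺ (u ≤?_) u∈ ≤-refl))
  ... | inj₁ u∈rs = u∈rs
  ... | inj₂ (here refl) = ⊥-elim (z≢u refl)
  u<z : u < z
  u<z = ≤∧≢⇒< (proj₂ (∈-filter⁻ (u ≤?_) {xs = q} (subst (z ∈_) (sym above≡) (∈-++⁺ʳ (reverse s) (here refl)))))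
              (λ { refl → z≢u refl })

popAll-pop : ∀ m s → popAll (m ∷ s) m ≡ popAll s (suc m)
popAll-pop m s with m ≡ᵇ m | ≡⇒≡ᵇ m m refl
... | true | _ = refl

popAll-stuck : ∀ {x m} s → x ≢ m → popAll (x ∷ s) m ≡ (x ∷ s , m)
popAll-stuck {x} {m} s x≢m with x ≡ᵇ m | ≡ᵇ⇒≡ x m
... | true  | x≡m = ⊥-elim (x≢m (x≡m tt))
... | false | _   = refl

PopsUpTo : List ℕ → ℕ → List ℕ → Set
PopsUpTo q m s = ∃ λ m* → m ≤ m* × popAll s m ≡ (reverse (above m* q) , m*) ×
  (∀ u → m ≤ u → u < m* → OnTop q u) × ¬ OnTop q m*

pop-all : ∀ q → Unique q → ∀ s m → s ≡ reverse (above m q) → PopsUpTo q m s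
pop-all q uq [] m stack = m , ≤-refl , cong (_, m) stack , (λ u m≤u u<m → ⊥-elim (<⇒≱ u<m m≤u)) , not-top
  where
  not-top : ¬ OnTop q m
  not-top (s , top) with trans stack top
  ... | ()
pop-all q uq (x ∷ s) m stack with x ≟ m
... | no x≢m = m , ≤-refl , trans (popAll-stuck s x≢m) (cong (_, m) stack) ,
               (λ u m≤u u<m → ⊥-elim (<⇒≱ u<m m≤u)) , λ (s′ , top) → x≢m (∷-injectiveˡ (trans stack top))
... | yes refl with pop-all q uq s (suc m) (sym (pop-step {q} uq (sym stack)))
... | m* , m<m* , pops , on-top , stuck =
  m* , ≤-trans (n≤1+n m) m<m* , trans (popAll-pop m s) pops , on-top′ , stuck
  where
  on-top′ : ∀ u → m ≤ u → u < m* → OnTop q u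
  on-top′ u m≤u u<m* with m ≟ u
  ... | yes refl = s , sym stack
  ... | no m≢u = on-top u (≤∧≢⇒< m≤u m≢u) u<m*

-- After reading q and popping greedily, the next value to output is the
-- threshold of q: the least value ≥ m0 that is absent from q or is the '2'
-- of an occurrence of 231 in q.
record IsThreshold (m0 : ℕ) (q : List ℕ) (M : ℕ) : Set where
  field
    start≤ : m0 ≤ M
    blocked : M ∉ q ⊎ IsTwo M q
    below : ∀ u → m0 ≤ u → u < M → u ∈ q × ¬ IsTwo u q

threshold-[] : ∀ m0 → IsThreshold m0 [] m0
threshold-[] m0 = record { start≤ = ≤-refl ; blocked = inj₁ λ () ; below = λ u m0≤u u<m0 → ⊥-elim (<⇒≱ u<m0 m0≤u) }

threshold≤fresh : ∀ {m0 p m x} → IsThreshold m0 p m → x ∉ p → m0 ≤ x → m ≤ x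
threshold≤fresh thr x∉p m0≤x = ≮⇒≥ λ x<m → x∉p (proj₁ (IsThreshold.below thr _ m0≤x x<m))

isTwo-∷ʳ⁻ : ∀ {u} p x → IsTwo u (p ++ [ x ]) → IsTwo u p ⊎ x < u
isTwo-∷ʳ⁻ {u} p x (b , c , ubc⊆ , u<b , c<u) with ⊆-∷ʳ⁻ p x ubc⊆
... | inj₁ ubc⊆p = inj₁ (b , c , ubc⊆p , u<b , c<u)
... | inj₂ (l′ , ubc≡) = inj₂ (subst (_< u) (∷ʳ-injectiveʳ (u ∷ b ∷ []) l′ ubc≡) c<u)

covered-∷ʳ⁻ : ∀ {u} p x → Covered (p ++ [ x ]) u → Covered p u ⊎ u < x
covered-∷ʳ⁻ {u} p x (b , ub⊆ , u<b) with ⊆-∷ʳ⁻ p x ub⊆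
... | inj₁ ub⊆p = inj₁ (b , ub⊆p , u<b)
... | inj₂ (l′ , ub≡) = inj₂ (subst (u <_) (∷ʳ-injectiveʳ (u ∷ []) l′ ub≡) u<b)

module ThresholdStep {m0 m m* x : ℕ} {p : List ℕ} (uq : Unique (p ++ [ x ])) (m0≤x : m0 ≤ x)
  (thr : IsThreshold m0 p m) (m≤m* : m ≤ m*)
  (popped : ∀ u → m ≤ u → u < m* → OnTop (p ++ [ x ]) u) (stuck : ¬ OnTop (p ++ [ x ]) m*) where

  open IsThreshold thr

  x∉p : x ∉ p
  x∉p = unique-∷ʳ⇒∉ p uq

  m≤x : m ≤ x
  m≤x = threshold≤fresh thr x∉p m0≤x

  popped-ok : ∀ {u} → OnTop (p ++ [ x ]) u → u ∈ p ++ [ x ] × ¬ IsTwo u (p ++ [ x ])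
  popped-ok top = onTop⇒∈ top , onTop⇒¬covered uq top ∘ isTwo⇒covered

  -- Values below m were output before x was read; those from m on were popped.
  below′ : ∀ u → m0 ≤ u → u < m* → u ∈ p ++ [ x ] × ¬ IsTwo u (p ++ [ x ])
  below′ u m0≤u u<m* with u <? m
  ... | no u≮m = popped-ok (popped u (≮⇒≥ u≮m) u<m*)
  ... | yes u<m = ∈-++⁺ˡ (proj₁ (below u m0≤u u<m)) , not-two
    where
    not-two : ¬ IsTwo u (p ++ [ x ])
    not-two two with isTwo-∷ʳ⁻ p x two
    ... | inj₁ two-p = proj₂ (below u m0≤u u<m) two-p
    ... | inj₂ x<u = <⇒≱ (<-trans x<u u<m) m≤x

  stays : ¬ OnTop (p ++ [ x ]) m → m* ≡ m
  stays ¬top with m≤n⇒m<n∨m≡n m≤m*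
  ... | inj₁ m<m* = ⊥-elim (¬top (popped m ≤-refl m<m*))
  ... | inj₂ m≡m* = sym m≡m*

  -- If m was a '2', or absent and different from x, nothing is popped.  If
  -- m = x, then m* is absent, or covered by some y in p so that m*, y, x
  -- form a 231.
  blocked′ : m* ∉ p ++ [ x ] ⊎ IsTwo m* (p ++ [ x ])
  blocked′ with blocked
  ... | inj₂ (b , c , mbc⊆ , m<b , c<m) =
    inj₂ (subst (λ v → IsTwo v _) (sym (stays λ top → proj₂ (popped-ok top) two)) two)
    where
    two : IsTwo m (p ++ [ x ])
    two = b , c , ⊆-trans mbc⊆ (++⁺ʳ [ x ] ⊆-refl) , m<b , c<m
  ... | inj₁ m∉p with m ≟ x
  ...   | no m≢x = inj₁ (subst (_∉ _) (sym (stays (m∉q ∘ onTop⇒∈))) m∉q)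
    where
    m∉q : m ∉ p ++ [ x ]
    m∉q m∈ with ∈-++⁻ p m∈
    ... | inj₁ m∈p = m∉p m∈p
    ... | inj₂ (here m≡x) = m≢x m≡x
  ...   | yes refl with m* ∈? (p ++ [ x ])
  ...     | no m*∉ = inj₁ m*∉
  ...     | yes m*∈ with covered-∷ʳ⁻ p x (¬onTop⇒covered m*∈ stuck)
  ...       | inj₂ m*<x = ⊥-elim (<⇒≱ m*<x m≤m*)
  ...       | inj₁ (y , m*y⊆p , m*<y) = inj₂ (y , x , ++⁺ m*y⊆p ⊆-refl , m*<y , x<m*)
    where
    x<m* : x < m*
    x<m* = ≤∧≢⇒< m≤m* λ { refl → x∉p (to∈ (⊆-trans (refl ∷ minimum _) m*y⊆p)) }

  threshold-step : IsThreshold m0 (p ++ [ x ]) m*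
  threshold-step = record { start≤ = ≤-trans start≤ m≤m* ; blocked = blocked′ ; below = below′ }

push-above : ∀ {m x} p → m ≤ x → x ∷ reverse (above m p) ≡ reverse (above m (p ++ [ x ]))
push-above {m} {x} p m≤x = sym (begin
  reverse (above m (p ++ [ x ]))                       ≡⟨ cong reverse (filter-++ (m ≤?_) p [ x ]) ⟩
  reverse (above m p ++ filter (m ≤?_) [ x ])           ≡⟨ cong (λ l → reverse (above m p ++ l)) (filter-accept (m ≤?_) m≤x) ⟩
  reverse (above m p ++ [ x ])                         ≡⟨ reverse-++ (above m p) [ x ] ⟩
  x ∷ reverse (above m p)                              ∎)
  where open ≡-Reasoning

-- The state of a pass after reading q and popping greedily: the stack
-- holds the entries of q not yet output, and m is the threshold of q.
Settled : ℕ → List ℕ → ℕ → List ℕ → Set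
Settled m0 q m s = s ≡ reverse (above m q) × IsThreshold m0 q m

settle-push : ∀ {m0 m x s} p → Unique (p ++ [ x ]) → m0 ≤ x → Settled m0 p m s →
  ∃ λ m* → popAll (x ∷ s) m ≡ (reverse (above m* (p ++ [ x ])) , m*) × IsThreshold m0 (p ++ [ x ]) m*
settle-push {m0} {m} {x} p uq m0≤x (refl , thr)
  with pop-all (p ++ [ x ]) uq (x ∷ reverse (above m p)) m
         (push-above p (threshold≤fresh thr (unique-∷ʳ⇒∉ p uq) m0≤x))
... | m* , m≤m* , pops , popped , stuck =
  m* , pops , ThresholdStep.threshold-step uq m0≤x thr m≤m* popped stuck

passGo-settled : ∀ {m0 Z} ys q {s m s′ m′} → q ++ ys ≡ Z → Unique Z → All (m0 ≤_) Z →
  popAll s m ≡ (s′ , m′) → Settled m0 q m′ s′ →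
  ∃ λ M → passGo ys s m ≡ (reverse (above M Z) , M) × IsThreshold m0 Z M
passGo-settled [] q refl uq bounded pops (refl , thr) rewrite ++-identityʳ q = _ , pops , thr
passGo-settled (x ∷ ys) q Z≡ uq bounded pops settled rewrite pops
  with settle-push q (unique-⊆ uq prefix⊆Z) (All.lookup bounded (subst (x ∈_) Z≡ (∈-++⁺ʳ q (here refl)))) settled
  where
  prefix⊆Z : q ++ [ x ] ⊆ _
  prefix⊆Z = subst (q ++ [ x ] ⊆_) (trans (++-assoc q [ x ] ys) Z≡) (++⁺ʳ ys ⊆-refl)
... | m* , pops′ , thr′ =
  passGo-settled ys (q ++ [ x ]) (trans (++-assoc q [ x ] ys) Z≡) uq bounded pops′ (refl , thr′)

-- The inputs that occur when sorting a permutation: distinct entries ≥ m0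
-- filling an interval that starts at m0 (m0 is the smallest value not yet
-- output).
record Good (m0 : ℕ) (Z : List ℕ) : Set where
  field
    distinct : Unique Z
    bounded : All (m0 ≤_) Z
    interval : ∀ {y u} → y ∈ Z → m0 ≤ u → u ≤ y → u ∈ Z

above-threshold : ∀ {m0 Z M} → Good m0 Z → IsThreshold m0 Z M → above M Z ≡ filter (survives? Z) Z
above-threshold {m0} {Z} {M} good thr = filter-cong (M ≤?_) (survives? Z) Z λ y∈ → mk⇔ (to y∈) from
  where
  open Good good
  open IsThreshold thr
  to : ∀ {y} → y ∈ Z → M ≤ y → Survives Z y
  to y∈ M≤y with blocked
  ... | inj₁ M∉Z = ⊥-elim (M∉Z (interval y∈ start≤ M≤y))
  ... | inj₂ two = lose (∈-twos⁺ Z two) M≤y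
  from : ∀ {y} → Survives Z y → M ≤ y
  from sv with find sv
  ... | w , w∈ , w≤y = ≤-trans (≮⇒≥ λ w<M → proj₂ (below w (All.lookup bounded (∈-twos⇒∈ Z w∈)) w<M) (∈-twos⁻ Z w∈)) w≤y

good-above : ∀ {m0 Z M} → Good m0 Z → m0 ≤ M → Good M (reverse (above M Z))
good-above {m0} {Z} {M} good m0≤M = record
  { distinct = stack-unique M distinct
  ; bounded = All.tabulate λ y∈ → proj₂ (∈-filter⁻ (M ≤?_) {xs = Z} (∈-reverse⁻ y∈))
  ; interval = λ y∈ M≤u u≤y → ∈-reverse⁺ (∈-filter⁺ (M ≤?_)
      (interval (proj₁ (∈-filter⁻ (M ≤?_) {xs = Z} (∈-reverse⁻ y∈))) (≤-trans m0≤M M≤u) u≤y) M≤u)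
  }
  where open Good good

passGo-good : ∀ {m0 Z} → Good m0 Z → ∃ λ M → passGo Z [] m0 ≡ (pass Z , M) × Good M (pass Z)
passGo-good {m0} {Z} good
  with passGo-settled Z [] refl (Good.distinct good) (Good.bounded good) refl (refl , threshold-[] m0)
... | M , run , thr =
  M , trans run (cong (λ l → reverse l , M) kept) , subst (Good M ∘ reverse) kept (good-above good (IsThreshold.start≤ thr))
  where
  kept : above M Z ≡ filter (survives? Z) Z
  kept = above-threshold good thr

runPasses-good : ∀ k {m0 Z} → Good m0 Z → runPasses k Z m0 ≡ passes k Z
runPasses-good zero good = refl
runPasses-good (suc k) {m0} {Z} good with passGo-good good
... | M , run , good′ rewrite run = runPasses-good k good′

∈-perm⁻ : ∀ {π y} → IsPerm π → y ∈ π → 1 ≤ y × y ≤ length π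
∈-perm⁻ {π} perm y∈ with ∈-map⁻ suc (∈-resp-↭ perm y∈)
... | i , i∈ , refl = s≤s z≤n , ∈-upTo⁻ i∈

∈-perm⁺ : ∀ {π y} → IsPerm π → 1 ≤ y → y ≤ length π → y ∈ π
∈-perm⁺ {π} {suc i} perm _ y≤n = ∈-resp-↭ (↭-sym perm) (∈-map⁺ suc (∈-upTo⁺ y≤n))

unique-1-to-n : ∀ n → Unique (map suc (upTo n))
unique-1-to-n n = Unique.map⁺ suc-injective (Unique.upTo⁺ n)

perm-good : ∀ {π} → IsPerm π → Good 1 π
perm-good {π} perm = record
  { distinct = unique-↭ (↭-sym perm) (unique-1-to-n (length π))
  ; bounded = All.tabulate λ y∈ → proj₁ (∈-perm⁻ perm y∈)
  ; interval = λ y∈ 1≤u u≤y → ∈-perm⁺ perm 1≤u (≤-trans u≤y (proj₂ (∈-perm⁻ perm y∈)))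
  }

runPasses-perm : ∀ k {π} → IsPerm π → runPasses k π 1 ≡ passes k π
runPasses-perm k perm = runPasses-good k (perm-good perm)

perm⇔ : ∀ σ → IsPerm σ ⇔ (Unique σ × All (_∈ map suc (upTo (length σ))) σ)
perm⇔ σ = mk⇔
  (λ perm → unique-↭ (↭-sym perm) (unique-1-to-n _) , All.tabulate (∈-resp-↭ perm))
  (λ (uσ , in-range) → pigeonhole σ _ uσ (unique-1-to-n _) (All.lookup in-range)
     (≤-reflexive (trans (length-map suc (upTo (length σ))) (length-upTo (length σ)))))

rank : List ℕ → ℕ → ℕ
rank τ y = suc (length (filter (_<? y) τ))

standardise : List ℕ → List ℕ
standardise τ = map (rank τ) τ

rank-strict : ∀ τ → StrictOn (rank τ) τ
rank-strict τ {x} {y} x∈ y∈ x<y = s≤s (begin-strict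
  length (filter (_<? x) τ)                   ≡⟨ cong length (sym (filter-absorb (_<? x) (_<? y) (λ z<x → <-trans z<x x<y) τ)) ⟩
  length (filter (_<? x) (filter (_<? y) τ))  <⟨ filter-notAll (_<? x) _ (lose (∈-filter⁺ (_<? y) x∈ x<y) (<-irrefl refl)) ⟩
  length (filter (_<? y) τ)                   ∎)
  where open ≤-Reasoning

rank≤length : ∀ τ {y} → y ∈ τ → rank τ y ≤ length τ
rank≤length τ y∈ = filter-notAll (_<? _) τ (lose y∈ (<-irrefl refl))

standardise-perm : ∀ τ → Unique τ → IsPerm (standardise τ)
standardise-perm τ uτ = Equivalence.from (perm⇔ (standardise τ))
  ( unique-map (rank-strict τ) uτ
  , All.tabulate λ r∈ → let y , y∈ , r≡ = ∈-map⁻ (rank τ) r∈ in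
      subst (_∈ _) (sym r≡) (∈-map⁺ suc (∈-upTo⁺ (subst (length (filter (_<? y) τ) <_)
        (sym (length-map (rank τ) τ)) (rank≤length τ y∈)))) )

lookup-map : ∀ (f : ℕ → ℕ) l (i : Fin (length (map f l))) → lookup (map f l) i ≡ f (lookup l (Fin.cast (length-map f l) i))
lookup-map f (x ∷ l) Fin.zero = refl
lookup-map f (x ∷ l) (Fin.suc i) = lookup-map f l i

standardise-iso : ∀ τ → OrderIso (standardise τ) τ
standardise-iso τ = length-map (rank τ) τ , λ i j →
  subst₂ (λ a b → (a < b) ⇔ (lookup τ (Fin.cast (length-map (rank τ) τ) i) < lookup τ (Fin.cast (length-map (rank τ) τ) j))) (sym (lookup-map (rank τ) τ i)) (sym (lookup-map (rank τ) τ j))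
    (mk⇔ (strictOn-<⁻ (rank-strict τ) (∈-lookup _) (∈-lookup _)) (rank-strict τ (∈-lookup _) (∈-lookup _)))

SmallUnsortable : ℕ → List ℕ → Set
SmallUnsortable t β =
  ∃ λ σ → IsPerm σ × Contains β σ × length σ ≤ witnessBound (suc t) × ¬ RevPassSortable t σ

standardise-witness : ∀ t {β τ} → IsPerm β → τ ⊆ β → length τ ≤ witnessBound (suc t) →
  passes (suc t) τ ≢ [] → SmallUnsortable t β
standardise-witness t {β} {τ} permβ τ⊆β τ-length τ-survives =
  standardise τ , permσ , (τ , τ⊆β , standardise-iso τ) ,
  subst (_≤ witnessBound (suc t)) (sym (length-map (rank τ) τ)) τ-length , σ-unsortable
  where
  permσ : IsPerm (standardise τ)
  permσ = standardise-perm τ (unique-⊆ (Good.distinct (perm-good permβ)) τ⊆β)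
  map-[] : ∀ {f : ℕ → ℕ} {l} → map f l ≡ [] → l ≡ []
  map-[] {l = []} _ = refl
  σ-unsortable : ¬ RevPassSortable t (standardise τ)
  σ-unsortable sorted = τ-survives (map-[] (begin
    map (rank τ) (passes (suc t) τ)     ≡⟨ sym (passes-map (suc t) τ (rank-strict τ)) ⟩
    passes (suc t) (standardise τ)      ≡⟨ sym (runPasses-perm (suc t) permσ) ⟩
    runPasses (suc t) (standardise τ) 1 ≡⟨ sorted ⟩
    []                                  ∎))
    where open ≡-Reasoning

small-unsortable : ∀ t {β} → IsPerm β → ¬ RevPassSortable t β → SmallUnsortable t β
small-unsortable t {β} permβ unsortable =
  let τ , τ⊆β , τ-length , τ-survives =
        small-witness (suc t) β (λ none → unsortable (trans (runPasses-perm (suc t) permβ) none))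
  in standardise-witness t permβ τ⊆β τ-length τ-survives

-- Hence every basis element has at most 3(t+1) + 1 entries: a shorter
-- unsortable pattern would contradict minimality.
basis-bound : ∀ t {β} → IsBasisElement t β → length β ≤ witnessBound (suc t)
basis-bound t {β} (permβ , unsortable , minimal) =
  let σ , permσ , σ⊑β , σ-length , σ-unsortable = small-unsortable t permβ unsortable
  in by-minimality permσ σ⊑β σ-length σ-unsortable (≡-dec _≟_ σ β)
  where
  by-minimality : ∀ {σ} → IsPerm σ → Contains β σ → length σ ≤ witnessBound (suc t) →
    ¬ RevPassSortable t σ → Dec (σ ≡ β) → length β ≤ witnessBound (suc t)
  by-minimality _ _ σ-length _ (yes refl) = σ-length
  by-minimality permσ σ⊑β _ σ-unsortable (no σ≢β) = ⊥-elim (σ-unsortable (minimal _ permσ σ⊑β σ≢β))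

boundedLists : ℕ → ℕ → List (List ℕ)
boundedLists n zero = [] ∷ []
boundedLists n (suc k) = [] ∷ cartesianProductWith _∷_ (upTo (suc n)) (boundedLists n k)

∈-boundedLists : ∀ n k {l} → length l ≤ k → All (_≤ n) l → l ∈ boundedLists n k
∈-boundedLists n zero {[]} _ _ = here refl
∈-boundedLists n (suc k) {[]} _ _ = here refl
∈-boundedLists n (suc k) {x ∷ l} (s≤s l-length) (x≤n ∷ l≤n) =
  there (∈-cartesianProductWith⁺ _∷_ (∈-upTo⁺ (s≤s x≤n)) (∈-boundedLists n k l-length l≤n))

sublists : List ℕ → List (List ℕ)
sublists [] = [] ∷ []
sublists (x ∷ xs) = map (x ∷_) (sublists xs) ++ sublists xs

∈-sublists : ∀ {τ xs} → τ ⊆ xs → τ ∈ sublists xs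
∈-sublists [] = here refl
∈-sublists {xs = y ∷ xs} (_ ∷ʳ τ⊆) = ∈-++⁺ʳ (map (y ∷_) (sublists xs)) (∈-sublists τ⊆)
∈-sublists (refl ∷ τ⊆) = ∈-++⁺ˡ (∈-map⁺ (_ ∷_) (∈-sublists τ⊆))

∈-sublists⁻ : ∀ {τ} xs → τ ∈ sublists xs → τ ⊆ xs
∈-sublists⁻ [] (here refl) = []
∈-sublists⁻ (x ∷ xs) τ∈ with ∈-++⁻ (map (x ∷_) (sublists xs)) τ∈
... | inj₁ τ∈map = let ρ , ρ∈ , τ≡ = ∈-map⁻ (x ∷_) τ∈map in subst (_⊆ _) (sym τ≡) (refl ∷ ∈-sublists⁻ xs ρ∈)
... | inj₂ τ∈rest = x ∷ʳ ∈-sublists⁻ xs τ∈rest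

_⇔?_ : ∀ {A B : Set} → Dec A → Dec B → Dec (A ⇔ B)
a? ⇔? b? = map′ (λ (f , g) → mk⇔ f g) (λ e → Equivalence.to e , Equivalence.from e) ((a? →-dec b?) ×-dec (b? →-dec a?))

sortable? : ∀ t π → Dec (RevPassSortable t π)
sortable? t π = ≡-dec _≟_ (runPasses (suc t) π 1) []

perm? : ∀ σ → Dec (IsPerm σ)
perm? σ = map′ (Equivalence.from (perm⇔ σ)) (Equivalence.to (perm⇔ σ)) (unique? σ ×-dec All.all? (_∈? _) σ)

orderIso? : ∀ σ τ → Dec (OrderIso σ τ)
orderIso? σ τ with length σ ≟ length τ
... | no ≢length = no (≢length ∘ proj₁)
... | yes eq with Finᵖ.all? (λ i → Finᵖ.all? (λ j →
                  (lookup σ i <? lookup σ j) ⇔? (lookup τ (Fin.cast eq i) <? lookup τ (Fin.cast eq j))))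
...   | yes iso = yes (eq , iso)
...   | no ¬iso = no λ (eq′ , iso) → ¬iso (subst (λ e → ∀ i j → (lookup σ i < lookup σ j) ⇔ (lookup τ (Fin.cast e i) < lookup τ (Fin.cast e j))) (≡-irrelevant eq′ eq) iso)

contains? : ∀ β σ → Dec (Contains β σ)
contains? β σ = map′ (λ found → let τ , τ∈ , iso = find found in τ , ∈-sublists⁻ β τ∈ , iso)
                     (λ (τ , τ⊆ , iso) → lose (∈-sublists τ⊆) iso)
                     (any? (orderIso? σ) (sublists β))

-- The minimality clause only concerns permutations no longer than β, so
-- it is decided by checking finitely many candidates.
minimal? : ∀ t β → Dec (∀ σ → IsPerm σ → Contains β σ → σ ≢ β → RevPassSortable t σ)
minimal? t β = map′ (λ all-ok σ permσ σ⊑β → All.lookup all-ok (candidate σ permσ σ⊑β) permσ σ⊑β)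
                    (λ minimal → All.tabulate λ {σ} _ → minimal σ)
                    (All.all? (λ σ → perm? σ →-dec (contains? β σ →-dec (¬? (≡-dec _≟_ σ β) →-dec sortable? t σ)))
                              (boundedLists (length β) (length β)))
  where
  candidate : ∀ σ → IsPerm σ → Contains β σ → σ ∈ boundedLists (length β) (length β)
  candidate σ permσ (τ , τ⊆β , σ≡τ , _) = ∈-boundedLists _ _ σ≤β
    (All.tabulate λ y∈ → ≤-trans (proj₂ (∈-perm⁻ permσ y∈)) σ≤β)
    where σ≤β = ≤-trans (≤-reflexive σ≡τ) (length-mono-≤ τ⊆β)

basis? : ∀ t β → Dec (IsBasisElement t β)
basis? t β = perm? β ×-dec (¬? (sortable? t β) ×-dec minimal? t β)

mainTheorem6 : (t : ℕ) → HasFiniteBasis t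
mainTheorem6 t = filter (basis? t) (boundedLists N N) , λ β →
  mk⇔ (λ β∈ → proj₂ (∈-filter⁻ (basis? t) {xs = boundedLists N N} β∈))
      (λ basis → ∈-filter⁺ (basis? t) (candidate basis) basis)
  where
  N : ℕ
  N = witnessBound (suc t)
  candidate : ∀ {β} → IsBasisElement t β → β ∈ boundedLists N N
  candidate {β} basis = ∈-boundedLists N N (basis-bound t basis)
    (All.tabulate λ y∈ → ≤-trans (proj₂ (∈-perm⁻ (proj₁ basis) y∈)) (basis-bound t basis))
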